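{- Let $G=(X,\Gamma)$ be a finite connected undirected graph that is $m$-distance-regular with respect to a partition $\Gamma=\Gamma_1\sqcup\cdots\sqcup\Gamma_m$ and a monomial order $\le$ on $\mathbb{N}^m$, with set of $m$-distances $\mathcal{D}$ and intersection numbers $p_{ab}^c$ ($a,b,c\in\mathcal{D}$). Then $p_{ab}^c\neq0$ implies $a\le b+c$, $b\le a+c$ and $c\le a+b$.
   Context: A monomial order on $\mathbb{N}^m$ is a total order $\le$ such that $a\le b$ implies $a+c\le b+c$ for all $c$, and which is a well-ordering. $e_i$ is the $i$-th unit vector. The classes $\Gamma_i$ are nonempty; a walk is a finite sequence of edges $(\gamma_1,\dots,\gamma_L)$, $\gamma_j=(y_j,y_{j+1})$, joining $y_1$ and $y_{L+1}$; its $m$-length $\ell_m(\xi)\in\mathbb{N}^m$ has $i$-th coordinate the number of its edges in $\Gamma_i$. The $m$-distance $d_m(x,y)$ is the $\le$-minimum of the $m$-lengths of walks between $x$ and $y$; $\mathcal{D}$ is the set of all $m$-distances. $G$ is $m$-distance-regular w.r.t. the partition and $\le$ if $e_1,\dots,e_m\in\mathcal{D}$ and for all $a,b,c\in\mathcal{D}$ the number $p_{ab}^c$ of $z\in X$ with $d_m(x,z)=a$, $d_m(z,y)=b$ is the same for all $x,y$ with $d_m(x,y)=c$; these $p_{ab}^c$ are the intersection numbers. -}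

module Defs where

open import Level using (Level; _⊔_) renaming (suc to lsuc)
open import Data.Nat using (ℕ; _+_)
open import Data.Fin using (Fin)
open import Data.Maybe using (Maybe; just; nothing)
open import Data.Vec using (Vec; replicate; zipWith; _[_]≔_)
open import Data.Fin.Subset using (Subset; _∈_; ∣_∣)
open import Data.Product using (Σ; ∃; ∃-syntax; _×_; proj₁; proj₂)
open import Function.Bundles using (_⇔_)
open import Relation.Binary.Core using (Rel)
open import Relation.Binary.Structures using (IsTotalOrder)
open import Relation.Binary.PropositionalEquality using (_≡_; _≢_)
open import Induction.WellFounded using (WellFounded)

ℕ^ : ℕ → Set
ℕ^ m = Vec ℕ m

_⊕_ : ∀ {m} → ℕ^ m → ℕ^ m → ℕ^ m
_⊕_ = zipWith _+_

infixl 6 _⊕_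

𝟎 : ∀ {m} → ℕ^ m
𝟎 = replicate _ 0

e : ∀ {m} → Fin m → ℕ^ m
e i = 𝟎 [ i ]≔ 1

record MonomialOrder (m : ℕ) (ℓ : Level) : Set (lsuc ℓ) where
  field
    _≼_          : Rel (ℕ^ m) ℓ
    isTotalOrder : IsTotalOrder _≡_ _≼_
    compatible   : ∀ a b c → a ≼ b → (a ⊕ c) ≼ (b ⊕ c)
    wellFounded  : WellFounded (λ a b → (a ≼ b) × (a ≢ b))

-- A finite undirected simple graph on vertex set Fin n together with a
-- partition of its edge set into m classes Γ_1, ..., Γ_m:
-- col x y ≡ just i  means {x,y} is an edge belonging to class Γ_i,
-- col x y ≡ nothing means x,y are not adjacent.
record PartitionedGraph (n m : ℕ) : Set where
  field
    col    : Fin n → Fin n → Maybe (Fin m)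
    sym    : ∀ x y → col x y ≡ col y x
    irrefl : ∀ x → col x x ≡ nothing

module _ {n m : ℕ} (G : PartitionedGraph n m) where
  open PartitionedGraph G

  data Walk : Fin n → Fin n → Set where
    []  : ∀ x → Walk x x
    _∷_ : ∀ {x y z i} → col x y ≡ just i → Walk y z → Walk x z

  mLength : ∀ {x y} → Walk x y → ℕ^ m
  mLength ([] x) = 𝟎
  mLength (_∷_ {i = i} _ w) = e i ⊕ mLength w

  ClassesNonempty : Set
  ClassesNonempty = ∀ i → ∃[ x ] ∃[ y ] (col x y ≡ just i)

  Connected : Set
  Connected = ∀ x y → Walk x y

  module _ {ℓ : Level} (O : MonomialOrder m ℓ) where
    open MonomialOrder O

    -- d_m(x,y) ≡ a : a is the ≼-minimum of m-lengths of walks x → y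
    IsMDist : Fin n → Fin n → ℕ^ m → Set ℓ
    IsMDist x y a =
      (Σ (Walk x y) λ w → mLength w ≡ a) × (∀ (w : Walk x y) → a ≼ mLength w)

    InD : ℕ^ m → Set ℓ
    InD a = ∃[ x ] ∃[ y ] IsMDist x y a

    NumberOf : (Fin n → Set ℓ) → ℕ → Set ℓ
    NumberOf P k = Σ (Subset n) λ S → (∀ z → (z ∈ S) ⇔ P z) × (∣ S ∣ ≡ k)

    -- m-distance-regularity; the witness ℕ is the intersection number p_ab^c
    IsMDistanceRegular : Set ℓ
    IsMDistanceRegular =
      (∀ i → InD (e i)) ×
      (∀ a b c → InD a → InD b → InD c →
        Σ ℕ λ p → ∀ x y → IsMDist x y c →
          NumberOf (λ z → IsMDist x z a × IsMDist z y b) p)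

    intersectionNumber : IsMDistanceRegular → ∀ a b c → InD a → InD b → InD c → ℕ
    intersectionNumber DR a b c aD bD cD = proj₁ (proj₂ DR a b c aD bD cD)

{-# OPTIONS --safe #-}
module Submission where

open import Defs
open import Level using (Level)
open import Data.Nat using (ℕ)
open import Data.Nat.Properties using (+-comm; +-assoc; +-identityˡ; +-identityʳ)
open import Data.Fin using (Fin)
open import Data.Fin.Subset using (Subset; ∣_∣; Nonempty)
open import Data.Fin.Subset.Properties using (nonempty?; Empty-unique; ∣⊥∣≡0)
open import Data.Vec.Properties using (zipWith-comm; zipWith-assoc; zipWith-identityˡ; zipWith-identityʳ)
open import Data.Product using (_×_; _,_; ∃; proj₂)
open import Function.Bundles using (Equivalence)
open import Relation.Nullary using (yes; no; contradiction)
open import Relation.Binary.PropositionalEquality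
  using (_≡_; _≢_; refl; sym; trans; cong; cong₂; subst; module ≡-Reasoning)

-- If p_ab^c ≠ 0, then for x, y at m-distance c there is a z with d(x,z) = a and d(z,y) = b.
-- Reversing a walk preserves its m-length, so d is symmetric, and concatenating minimal walks
-- gives the triangle inequality d(x,y) ≼ d(x,z) ⊕ d(z,y); applied at each of the three
-- vertices x, y, z it bounds each of a, b, c by the sum of the other two.

⊕-comm : ∀ {m} (a b : ℕ^ m) → a ⊕ b ≡ b ⊕ a
⊕-comm = zipWith-comm +-comm

⊕-assoc : ∀ {m} (a b c : ℕ^ m) → (a ⊕ b) ⊕ c ≡ a ⊕ (b ⊕ c)
⊕-assoc = zipWith-assoc +-assoc

⊕-identityˡ : ∀ {m} (a : ℕ^ m) → 𝟎 ⊕ a ≡ a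
⊕-identityˡ = zipWith-identityˡ +-identityˡ

⊕-identityʳ : ∀ {m} (a : ℕ^ m) → a ⊕ 𝟎 ≡ a
⊕-identityʳ = zipWith-identityʳ +-identityʳ

∣p∣≢0⇒Nonempty : ∀ {n} (p : Subset n) → ∣ p ∣ ≢ 0 → Nonempty p
∣p∣≢0⇒Nonempty {n} p ∣p∣≢0 with nonempty? p
... | yes p≠∅ = p≠∅
... | no  p≡∅ = contradiction (trans (cong ∣_∣ (Empty-unique p≡∅)) (∣⊥∣≡0 n)) ∣p∣≢0

module _ {n m : ℕ} (G : PartitionedGraph n m) where
  open PartitionedGraph G using () renaming (sym to col-sym)

  infixr 5 _++ʷ_

  _++ʷ_ : ∀ {x y z} → Walk G x y → Walk G y z → Walk G x z
  [] _    ++ʷ w = w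
  (p ∷ v) ++ʷ w = p ∷ (v ++ʷ w)

  mLength-++ : ∀ {x y z} (v : Walk G x y) (w : Walk G y z) →
               mLength G (v ++ʷ w) ≡ mLength G v ⊕ mLength G w
  mLength-++ ([] _) w = sym (⊕-identityˡ (mLength G w))
  mLength-++ (_∷_ {i = i} _ v) w = begin
    e i ⊕ mLength G (v ++ʷ w)          ≡⟨ cong (e i ⊕_) (mLength-++ v w) ⟩
    e i ⊕ (mLength G v ⊕ mLength G w)  ≡⟨ sym (⊕-assoc (e i) _ _) ⟩
    (e i ⊕ mLength G v) ⊕ mLength G w  ∎
    where open ≡-Reasoning

  reverseʷ : ∀ {x y} → Walk G x y → Walk G y x
  reverseʷ ([] x) = [] x
  reverseʷ (_∷_ {x = x} {y = y} p v) = reverseʷ v ++ʷ (trans (col-sym y x) p ∷ [] x)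

  mLength-reverse : ∀ {x y} (w : Walk G x y) → mLength G (reverseʷ w) ≡ mLength G w
  mLength-reverse ([] _) = refl
  mLength-reverse (_∷_ {i = i} p v) = begin
    mLength G (reverseʷ (p ∷ v))        ≡⟨ mLength-++ (reverseʷ v) _ ⟩
    mLength G (reverseʷ v) ⊕ (e i ⊕ 𝟎)  ≡⟨ cong₂ _⊕_ (mLength-reverse v) (⊕-identityʳ (e i)) ⟩
    mLength G v ⊕ e i                   ≡⟨ ⊕-comm (mLength G v) (e i) ⟩
    e i ⊕ mLength G v                   ∎
    where open ≡-Reasoning

  module _ {ℓ : Level} (O : MonomialOrder m ℓ) where
    open MonomialOrder O using (_≼_)

    IsMDist-sym : ∀ {x y a} → IsMDist G O x y a → IsMDist G O y x a
    IsMDist-sym {a = a} ((w , ∣w∣≡a) , a-min) =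
        (reverseʷ w , trans (mLength-reverse w) ∣w∣≡a)
      , λ v → subst (a ≼_) (mLength-reverse v) (a-min (reverseʷ v))

    IsMDist-triangle : ∀ {x y z a b c} →
      IsMDist G O x z a → IsMDist G O z y b → IsMDist G O x y c → c ≼ (a ⊕ b)
    IsMDist-triangle ((v , ∣v∣≡a) , _) ((w , ∣w∣≡b) , _) (_ , c-min) =
      subst (_ ≼_) (trans (mLength-++ v w) (cong₂ _⊕_ ∣v∣≡a ∣w∣≡b)) (c-min (v ++ʷ w))

    IsMDist-triangles : ∀ {x y z a b c} →
      IsMDist G O x z a → IsMDist G O z y b → IsMDist G O x y c →
      a ≼ (b ⊕ c) × b ≼ (a ⊕ c) × c ≼ (a ⊕ b)
    IsMDist-triangles {a = a} {b} {c} dxz dzy dxy =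
        subst (a ≼_) (⊕-comm c b) (IsMDist-triangle dxy (IsMDist-sym dzy) dxz)
      , IsMDist-triangle (IsMDist-sym dxz) dxy dzy
      , IsMDist-triangle dxz dzy dxy

    NumberOf-≢0⇒∃ : ∀ {P : Fin n → Set ℓ} {k} → NumberOf G O P k → k ≢ 0 → ∃ P
    NumberOf-≢0⇒∃ (S , S⇔P , ∣S∣≡k) k≢0
      with z , z∈S ← ∣p∣≢0⇒Nonempty S (λ ∣S∣≡0 → k≢0 (trans (sym ∣S∣≡k) ∣S∣≡0))
      = z , Equivalence.to (S⇔P z) z∈S

    intersectionNumber-≢0⇒∃ : (DR : IsMDistanceRegular G O) →
      ∀ {a b c} (aD : InD G O a) (bD : InD G O b) (cD : InD G O c) →
      intersectionNumber G O DR a b c aD bD cD ≢ 0 →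
      ∀ {x y} → IsMDist G O x y c → ∃ λ z → IsMDist G O x z a × IsMDist G O z y b
    intersectionNumber-≢0⇒∃ (_ , regular) {a} {b} {c} aD bD cD p≢0 {x} {y} dxy =
      NumberOf-≢0⇒∃ (proj₂ (regular a b c aD bD cD) x y dxy) p≢0

lemma3p10 : {n m : ℕ} {ℓ : Level} (G : PartitionedGraph n m) (O : MonomialOrder m ℓ) →
    ClassesNonempty G → Connected G →
    (DR : IsMDistanceRegular G O) →
    ∀ a b c (aD : InD G O a) (bD : InD G O b) (cD : InD G O c) →
    intersectionNumber G O DR a b c aD bD cD ≢ 0 →
    MonomialOrder._≼_ O a (b ⊕ c) × MonomialOrder._≼_ O b (a ⊕ c) × MonomialOrder._≼_ O c (a ⊕ b)
lemma3p10 G O _ _ DR a b c aD bD cD@(_ , _ , dxy) p≢0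
  with _ , dxz , dzy ← intersectionNumber-≢0⇒∃ G O DR aD bD cD p≢0 dxy
  = IsMDist-triangles G O dxz dzy dxy
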